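{- In the setting below, every no-regret algorithm whose computed action sequence has average regret per time step $\epsilon<\frac14\cdot\frac{\delta^2}{2-\delta}$ (for every link), using the utility $u$ below, computes an action sequence that is $\left(\frac{\delta}{2},\epsilon\right)$-successful and $\delta$-blocking.
   Context: Links in a set $V$ share one channel in synchronized time steps. Conflict graph: weights $b_u(v)\ge0$; if a set $L$ transmits, $v\in L$ succeeds iff the step is not jammed for $v$ and $\sum_{u\in L}b_u(v)\le1$. The adversary is $(T',1-\delta)$-bounded (at most a $(1-\delta)$-fraction of any window of at least $T'$ consecutive steps jammed, possibly individually per link); jammed transmissions fail. Each link decides in every step whether to transmit (phases of length 1; a phase/step is successful iff the link transmits successfully). Utility in step $t$: $1$ if $\ell_i$ transmits successfully, $-\frac{\delta}{2-\delta}$ if it transmits unsuccessfully, $0$ otherwise. Average regret: (max over the two constant actions of the total utility they would have obtained, minus total utility obtained)/(number of steps). $q_v$ = fraction of steps in which $v$ transmits; $w_v$ = fraction of steps in which $v$ transmits successfully; $f_v$ = fraction of steps in which $v$ would be unsuccessful due to interference from other links (regardless of whether $v$ transmits). $(\gamma,\epsilon)$-successful: $\frac1\gamma(2w_v+\epsilon)\ge q_v$ for all $v$. $\eta$-blocking: every $v$ with $q_v\le\frac14\eta$ has $f_v\ge\frac14\eta$ and $\sum_{u\in V}b_u(v)q_u\ge\frac18\eta$. -}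

module Defs where

open import Data.Nat as ℕ using (ℕ; zero; suc)
open import Data.Fin as Fin using (Fin)
open import Data.Bool using (Bool; true; false; if_then_else_; not; _∧_; _∨_)
open import Data.Integer using (+_)
open import Data.Rational using (ℚ; _+_; _*_; _-_; -_; _≤_; _≤ᵇ_; _⊔_; _/_; 0ℚ; 1ℚ)
open import Data.Product using (_×_)
open import Relation.Nullary.Decidable using () renaming (⌊_⌋ to isYes)

2ℚ : ℚ
2ℚ = + 2 / 1

𝟙 : Bool → ℚ
𝟙 true  = 1ℚ
𝟙 false = 0ℚ

ΣL : ∀ {n} → (Fin n → ℚ) → ℚ
ΣL {zero}  f = 0ℚ
ΣL {suc n} f = f Fin.zero + ΣL {n} (λ i → f (Fin.suc i))

ΣW : ℕ → ℕ → (ℕ → ℚ) → ℚ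
ΣW s zero      f = 0ℚ
ΣW s (suc len) f = f s + ΣW (suc s) len f

ΣT : ℕ → (ℕ → ℚ) → ℚ
ΣT T f = ΣW 0 T f

ℕ→ℚ : ℕ → ℚ
ℕ→ℚ k = + k / 1

frac : (T : ℕ) .{{_ : ℕ.NonZero T}} → (ℕ → Bool) → ℚ
frac T P = ΣT T (λ t → 𝟙 (P t)) * (+ 1 / T)

module Setting {n : ℕ}
  (b     : Fin n → Fin n → ℚ)   -- conflict-graph weights b u v = b_u(v)
  (trans : ℕ → Fin n → Bool)    -- trans t v : link v transmits in step t
  (jam   : ℕ → Fin n → Bool)    -- jam t v : step t is jammed for link v
  where

  load : ℕ → Fin n → ℚ
  load t v = ΣL (λ u → if trans t u then b u v else 0ℚ)

  -- Σ_{u ∈ L_t ∪ {v}} b_u(v): the interference v would face if it transmitted.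
  loadWith : ℕ → Fin n → ℚ
  loadWith t v = ΣL (λ u → if trans t u ∨ isYes (u Fin.≟ v) then b u v else 0ℚ)

  -- v would be unsuccessful in step t due to interference (regardless of
  -- whether v transmits).
  interfered : ℕ → Fin n → Bool
  interfered t v = not (loadWith t v ≤ᵇ 1ℚ)

  success : ℕ → Fin n → Bool
  success t v = trans t v ∧ not (jam t v) ∧ (load t v ≤ᵇ 1ℚ)

  -- v would transmit successfully in step t if it transmitted
  -- (the other links' actions unchanged).
  successIfTransmit : ℕ → Fin n → Bool
  successIfTransmit t v = not (jam t v) ∧ not (interfered t v)

  -- Utility of link v in step t (c is the failure penalty δ/(2-δ)).
  utility : ℚ → ℕ → Fin n → ℚ
  utility c t v =
    if trans t v then (if success t v then 1ℚ else - c) else 0ℚ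

  utilityAlways : ℚ → ℕ → Fin n → ℚ
  utilityAlways c t v = if successIfTransmit t v then 1ℚ else - c

  utilityNever : ℚ → ℕ → Fin n → ℚ
  utilityNever c t v = 0ℚ

  avgRegret : (T : ℕ) .{{_ : ℕ.NonZero T}} → ℚ → Fin n → ℚ
  avgRegret T c v =
    ((ΣT T (λ t → utilityAlways c t v) ⊔ ΣT T (λ t → utilityNever c t v))
      - ΣT T (λ t → utility c t v)) * (+ 1 / T)

  q : (T : ℕ) .{{_ : ℕ.NonZero T}} → Fin n → ℚ
  q T v = frac T (λ t → trans t v)

  w : (T : ℕ) .{{_ : ℕ.NonZero T}} → Fin n → ℚ
  w T v = frac T (λ t → success t v)

  f : (T : ℕ) .{{_ : ℕ.NonZero T}} → Fin n → ℚ
  f T v = frac T (λ t → interfered t v)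

  -- (γ, ε)-successful:  (1/γ)(2 w_v + ε) ≥ q_v  for all v,
  -- written multiplied out by γ (> 0) as  γ q_v ≤ 2 w_v + ε.
  Successful : (T : ℕ) .{{_ : ℕ.NonZero T}} → ℚ → ℚ → Set
  Successful T γ ε = ∀ v → γ * q T v ≤ 2ℚ * w T v + ε

  Blocking : (T : ℕ) .{{_ : ℕ.NonZero T}} → ℚ → Set
  Blocking T η = ∀ v → q T v ≤ (+ 1 / 4) * η →
    ((+ 1 / 4) * η ≤ f T v) × ((+ 1 / 8) * η ≤ ΣL (λ u → b u v * q T u))

Bounded : ∀ {n} → ℕ → ℚ → (ℕ → Fin n → Bool) → Set
Bounded T' δ jam = ∀ v s len → T' ℕ.≤ len →
  ΣW s len (λ t → 𝟙 (jam t v)) ≤ (1ℚ - δ) * ℕ→ℚ len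

-- Write c = δ/(2-δ) for the cost of a failed transmission.  The average utility of a link is
-- w - c(q - w), so small regret against "never transmit" gives w - c(q - w) ≥ -ε, and as
-- δ/2 ≤ c ≤ 1 this yields (δ/2) q ≤ 2w + ε.  Regret against "always transmit", multiplied by
-- 2 - δ, bounds the fraction σ of steps in which the link would succeed by
-- 2σ ≤ δ + 2w - δq + (2-δ)ε, which for q ≤ δ/4 and the assumed bound on ε gives σ ≤ 3δ/4.
-- Every step is one in which the link would succeed, or is jammed (at most a (1-δ)-fraction),
-- or is interfered, so f ≥ δ/4.  Since b_v(v) = 0, an interfered step has
-- Σ_{u transmitting} b_u(v) > 1, whence Σ_u b_u(v) q_u ≥ f.
module Submission where

open import Defs
open import Data.Nat as ℕ using (ℕ; zero; suc)
open import Data.Fin as Fin using (Fin)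
open import Data.Bool using (Bool; true; false; if_then_else_; not; _∧_; _∨_; T)
open import Data.Integer as ℤ using (+_)
open import Data.Integer.Tactic.RingSolver using (solve-∀)
open import Data.Rational
open import Data.Rational.Properties
import Data.Rational.Unnormalised as ℚᵘ
import Data.Rational.Unnormalised.Properties as ℚᵘ
open import Data.Rational.Solver using (module +-*-Solver)
open import Data.Product using (_×_; _,_)
open import Data.Unit using (tt)
open import Relation.Nullary using (yes; no)
open import Relation.Nullary.Decidable using () renaming (⌊_⌋ to isYes)
open import Relation.Binary.PropositionalEquality
  using (_≡_; refl; sym; cong; cong₂; subst; module ≡-Reasoning)
  renaming (trans to ≡-trans)

open +-*-Solver

ℕ→ℚ-suc : ∀ l → ℕ→ℚ (suc l) ≡ 1ℚ + ℕ→ℚ l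
ℕ→ℚ-suc l = toℚᵘ-injective (begin-equality
  toℚᵘ (ℕ→ℚ (suc l))             ≃⟨ toℚᵘ-fromℚᵘ (ℚᵘ.mkℚᵘ (+ suc l) 0) ⟩
  ℚᵘ.mkℚᵘ (+ suc l) 0             ≃⟨ ℚᵘ.*≡* (numerators (+ l)) ⟩
  ℚᵘ.1ℚᵘ ℚᵘ.+ ℚᵘ.mkℚᵘ (+ l) 0      ≃⟨ ℚᵘ.+-congʳ ℚᵘ.1ℚᵘ (toℚᵘ-fromℚᵘ (ℚᵘ.mkℚᵘ (+ l) 0)) ⟨
  toℚᵘ 1ℚ ℚᵘ.+ toℚᵘ (ℕ→ℚ l)       ≃⟨ toℚᵘ-homo-+ 1ℚ (ℕ→ℚ l) ⟨
  toℚᵘ (1ℚ + ℕ→ℚ l)               ∎)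
  where
  open ℚᵘ.≤-Reasoning
  numerators : ∀ x → (+ 1 ℤ.+ x) ℤ.* (+ 1 ℤ.* + 1) ≡ (+ 1 ℤ.* + 1 ℤ.+ x ℤ.* + 1) ℤ.* + 1
  numerators = solve-∀

ℕ→ℚ-*-inverse : (T : ℕ) .{{_ : ℕ.NonZero T}} → ℕ→ℚ T * (+ 1 / T) ≡ 1ℚ
ℕ→ℚ-*-inverse T@(suc _) = toℚᵘ-injective (begin-equality
  toℚᵘ (ℕ→ℚ T * (+ 1 / T))               ≃⟨ toℚᵘ-homo-* (ℕ→ℚ T) (+ 1 / T) ⟩
  toℚᵘ (ℕ→ℚ T) ℚᵘ.* toℚᵘ (+ 1 / T)        ≃⟨ ℚᵘ.*-cong (toℚᵘ-fromℚᵘ (ℚᵘ.mkℚᵘ (+ T) 0))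
                                                        (toℚᵘ-fromℚᵘ (ℚᵘ.mkℚᵘ (+ 1) (ℕ.pred T))) ⟩
  ℚᵘ.mkℚᵘ (+ T) 0 ℚᵘ.* ℚᵘ.1/ ℚᵘ.mkℚᵘ (+ T) 0 ≃⟨ ℚᵘ.*-inverseʳ (ℚᵘ.mkℚᵘ (+ T) 0) ⟩
  ℚᵘ.1ℚᵘ                                  ∎)
  where open ℚᵘ.≤-Reasoning

1/ℕ-nonNeg : (T : ℕ) .{{_ : ℕ.NonZero T}} → 0ℚ ≤ + 1 / T
1/ℕ-nonNeg T = nonNegative⁻¹ (+ 1 / T) {{normalize-nonNeg 1 T}}

p*[q÷p]≡q : ∀ p q .{{_ : NonZero p}} → p * (q ÷ p) ≡ q
p*[q÷p]≡q p q = begin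
  p * (q * 1/ p)   ≡⟨ solve 3 (λ p q r → p :* (q :* r) := q :* (p :* r)) refl p q (1/ p) ⟩
  q * (p * 1/ p)   ≡⟨ cong (q *_) (*-inverseʳ p) ⟩
  q * 1ℚ           ≡⟨ *-identityʳ q ⟩
  q                ∎
  where open ≡-Reasoning

ΣW-cong : ∀ s l {f g : ℕ → ℚ} → (∀ t → f t ≡ g t) → ΣW s l f ≡ ΣW s l g
ΣW-cong s zero    f≗g = refl
ΣW-cong s (suc l) f≗g = cong₂ _+_ (f≗g s) (ΣW-cong (suc s) l f≗g)

ΣW-mono-≤ : ∀ s l {f g : ℕ → ℚ} → (∀ t → f t ≤ g t) → ΣW s l f ≤ ΣW s l g
ΣW-mono-≤ s zero    f≤g = ≤-refl
ΣW-mono-≤ s (suc l) f≤g = +-mono-≤ (f≤g s) (ΣW-mono-≤ (suc s) l f≤g)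

ΣW-distrib-+ : ∀ s l (f g : ℕ → ℚ) → ΣW s l (λ t → f t + g t) ≡ ΣW s l f + ΣW s l g
ΣW-distrib-+ s zero    f g = refl
ΣW-distrib-+ s (suc l) f g = begin
  (f s + g s) + ΣW (suc s) l (λ t → f t + g t) ≡⟨ cong (λ x → (f s + g s) + x) (ΣW-distrib-+ (suc s) l f g) ⟩
  (f s + g s) + (F + G)                        ≡⟨ solve 4 (λ a b c d → (a :+ b) :+ (c :+ d) := (a :+ c) :+ (b :+ d))
                                                         refl (f s) (g s) F G ⟩
  (f s + F) + (g s + G)                        ∎
  where
  open ≡-Reasoning
  F = ΣW (suc s) l f
  G = ΣW (suc s) l g

*-distribˡ-ΣW : ∀ s l a (f : ℕ → ℚ) → a * ΣW s l f ≡ ΣW s l (λ t → a * f t)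
*-distribˡ-ΣW s zero    a f = *-zeroʳ a
*-distribˡ-ΣW s (suc l) a f =
  ≡-trans (*-distribˡ-+ a (f s) _) (cong (λ x → a * f s + x) (*-distribˡ-ΣW (suc s) l a f))

ΣW-const : ∀ s l a → ΣW s l (λ _ → a) ≡ a * ℕ→ℚ l
ΣW-const s zero    a = sym (*-zeroʳ a)
ΣW-const s (suc l) a = begin
  a + ΣW (suc s) l (λ _ → a)  ≡⟨ cong₂ _+_ (sym (*-identityʳ a)) (ΣW-const (suc s) l a) ⟩
  a * 1ℚ + a * ℕ→ℚ l          ≡⟨ *-distribˡ-+ a 1ℚ (ℕ→ℚ l) ⟨
  a * (1ℚ + ℕ→ℚ l)            ≡⟨ cong (a *_) (ℕ→ℚ-suc l) ⟨
  a * ℕ→ℚ (suc l)             ∎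
  where open ≡-Reasoning

ΣW-ΣL-comm : ∀ {n} s l (g : ℕ → Fin n → ℚ) →
             ΣW s l (λ t → ΣL (g t)) ≡ ΣL (λ u → ΣW s l (λ t → g t u))
ΣW-ΣL-comm {zero}  s l g = ≡-trans (ΣW-const s l 0ℚ) (*-zeroˡ (ℕ→ℚ l))
ΣW-ΣL-comm {suc n} s l g =
  ≡-trans (ΣW-distrib-+ s l (λ t → g t Fin.zero) (λ t → ΣL (λ u → g t (Fin.suc u))))
          (cong (λ x → ΣW s l (λ t → g t Fin.zero) + x) (ΣW-ΣL-comm s l (λ t u → g t (Fin.suc u))))

ΣL-cong : ∀ {n} {f g : Fin n → ℚ} → (∀ u → f u ≡ g u) → ΣL f ≡ ΣL g
ΣL-cong {zero}  f≗g = refl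
ΣL-cong {suc n} f≗g = cong₂ _+_ (f≗g Fin.zero) (ΣL-cong (λ u → f≗g (Fin.suc u)))

ΣL-nonNeg : ∀ {n} {f : Fin n → ℚ} → (∀ u → 0ℚ ≤ f u) → 0ℚ ≤ ΣL f
ΣL-nonNeg {zero}  f≥0 = ≤-refl
ΣL-nonNeg {suc n} f≥0 = +-mono-≤ (f≥0 Fin.zero) (ΣL-nonNeg (λ u → f≥0 (Fin.suc u)))

*-distribʳ-ΣL : ∀ {n} a (f : Fin n → ℚ) → ΣL f * a ≡ ΣL (λ u → f u * a)
*-distribʳ-ΣL {zero}  a f = *-zeroˡ a
*-distribʳ-ΣL {suc n} a f =
  ≡-trans (*-distribʳ-+ a (f Fin.zero) _) (cong (λ x → f Fin.zero * a + x) (*-distribʳ-ΣL a (λ u → f (Fin.suc u))))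

-- frac T P is, by definition, mean T (λ t → 𝟙 (P t)).
mean : (T : ℕ) .{{_ : ℕ.NonZero T}} → (ℕ → ℚ) → ℚ
mean T g = ΣT T g * (+ 1 / T)

module _ (T : ℕ) .{{_ : ℕ.NonZero T}} where

  mean-cong : {f g : ℕ → ℚ} → (∀ t → f t ≡ g t) → mean T f ≡ mean T g
  mean-cong f≗g = cong (_* (+ 1 / T)) (ΣW-cong 0 T f≗g)

  mean-mono-≤ : {f g : ℕ → ℚ} → (∀ t → f t ≤ g t) → mean T f ≤ mean T g
  mean-mono-≤ f≤g = *-monoʳ-≤-nonNeg (+ 1 / T) {{nonNegative (1/ℕ-nonNeg T)}} (ΣW-mono-≤ 0 T f≤g)

  mean-distrib-+ : ∀ (f g : ℕ → ℚ) → mean T (λ t → f t + g t) ≡ mean T f + mean T g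
  mean-distrib-+ f g = ≡-trans (cong (_* (+ 1 / T)) (ΣW-distrib-+ 0 T f g)) (*-distribʳ-+ (+ 1 / T) (ΣT T f) (ΣT T g))

  *-distribˡ-mean : ∀ a (f : ℕ → ℚ) → a * mean T f ≡ mean T (λ t → a * f t)
  *-distribˡ-mean a f = ≡-trans (sym (*-assoc a _ _)) (cong (_* (+ 1 / T)) (*-distribˡ-ΣW 0 T a f))

  *ℕ→ℚ-mean : ∀ a → a * ℕ→ℚ T * (+ 1 / T) ≡ a
  *ℕ→ℚ-mean a = begin
    a * ℕ→ℚ T * (+ 1 / T)    ≡⟨ *-assoc a (ℕ→ℚ T) (+ 1 / T) ⟩
    a * (ℕ→ℚ T * (+ 1 / T))  ≡⟨ cong (a *_) (ℕ→ℚ-*-inverse T) ⟩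
    a * 1ℚ                   ≡⟨ *-identityʳ a ⟩
    a                        ∎
    where open ≡-Reasoning

  mean-≤ : ∀ {f : ℕ → ℚ} a → ΣT T f ≤ a * ℕ→ℚ T → mean T f ≤ a
  mean-≤ a Σf≤aT = ≤-trans (*-monoʳ-≤-nonNeg (+ 1 / T) {{nonNegative (1/ℕ-nonNeg T)}} Σf≤aT)
                           (≤-reflexive (*ℕ→ℚ-mean a))

  mean-const : ∀ a → mean T (λ _ → a) ≡ a
  mean-const a = ≡-trans (cong (_* (+ 1 / T)) (ΣW-const 0 T a)) (*ℕ→ℚ-mean a)

  mean-nonNeg : {f : ℕ → ℚ} → (∀ t → 0ℚ ≤ f t) → 0ℚ ≤ mean T f
  mean-nonNeg f≥0 = ≤-trans (≤-reflexive (sym (mean-const 0ℚ))) (mean-mono-≤ f≥0)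

  mean-ΣL-comm : ∀ {n} (g : ℕ → Fin n → ℚ) → mean T (λ t → ΣL (g t)) ≡ ΣL (λ u → mean T (λ t → g t u))
  mean-ΣL-comm g = ≡-trans (cong (_* (+ 1 / T)) (ΣW-ΣL-comm 0 T g)) (*-distribʳ-ΣL (+ 1 / T) (λ u → ΣT T (λ t → g t u)))

𝟙-nonNeg : ∀ x → 0ℚ ≤ 𝟙 x
𝟙-nonNeg true  = ≤ᵇ⇒≤ tt
𝟙-nonNeg false = ≤-refl

𝟙-∧-≤ : ∀ x y → 𝟙 (x ∧ y) ≤ 𝟙 x
𝟙-∧-≤ true  y = 𝟙-≤-1 y
  where
  𝟙-≤-1 : ∀ y → 𝟙 y ≤ 1ℚ
  𝟙-≤-1 true  = ≤-refl
  𝟙-≤-1 false = ≤ᵇ⇒≤ tt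
𝟙-∧-≤ false y = ≤-refl

𝟙-cover : ∀ x y → 1ℚ ≤ 𝟙 (not x ∧ not y) + 𝟙 x + 𝟙 y
𝟙-cover true  true  = ≤ᵇ⇒≤ tt
𝟙-cover true  false = ≤ᵇ⇒≤ tt
𝟙-cover false true  = ≤ᵇ⇒≤ tt
𝟙-cover false false = ≤ᵇ⇒≤ tt

𝟙-exceeds-1 : ∀ {a} → 0ℚ ≤ a → 𝟙 (not (a ≤ᵇ 1ℚ)) ≤ a
𝟙-exceeds-1 {a} a≥0 with a ≤ᵇ 1ℚ in a≤ᵇ1
... | true  = a≥0
... | false = <⇒≤ (≰⇒> (λ a≤1 → subst T a≤ᵇ1 (≤⇒≤ᵇ a≤1)))

if-then-0≡*𝟙 : ∀ x a → (if x then a else 0ℚ) ≡ a * 𝟙 x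
if-then-0≡*𝟙 true  a = sym (*-identityʳ a)
if-then-0≡*𝟙 false a = sym (*-zeroʳ a)

-- The average utility of succeeding in an x-fraction and transmitting in a y-fraction of the
-- steps, when a failed transmission costs c.
payoff : ℚ → ℚ → ℚ → ℚ
payoff c x y = x - c * (y - x)

payoff-linear : ∀ c x y → payoff c x y ≡ (1ℚ + c) * x + (- c) * y
payoff-linear = solve 3 (λ c x y → x :- c :* (y :- x) := (con 1ℚ :+ c) :* x :+ (:- c) :* y) refl

mean-payoff : ∀ T .{{_ : ℕ.NonZero T}} c (f g : ℕ → ℚ) →
              mean T (λ t → payoff c (f t) (g t)) ≡ payoff c (mean T f) (mean T g)
mean-payoff T c f g = begin
  mean T (λ t → payoff c (f t) (g t))                        ≡⟨ mean-cong T (λ t → payoff-linear c (f t) (g t)) ⟩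
  mean T (λ t → (1ℚ + c) * f t + (- c) * g t)                ≡⟨ mean-distrib-+ T (λ t → (1ℚ + c) * f t) (λ t → (- c) * g t) ⟩
  mean T (λ t → (1ℚ + c) * f t) + mean T (λ t → (- c) * g t) ≡⟨ cong₂ _+_ (*-distribˡ-mean T (1ℚ + c) f) (*-distribˡ-mean T (- c) g) ⟨
  (1ℚ + c) * mean T f + (- c) * mean T g                     ≡⟨ payoff-linear c (mean T f) (mean T g) ⟨
  payoff c (mean T f) (mean T g)                             ∎
  where open ≡-Reasoning

payoff-𝟙 : ∀ c x y → (if x then (if x ∧ y then 1ℚ else - c) else 0ℚ) ≡ payoff c (𝟙 (x ∧ y)) (𝟙 x)
payoff-𝟙 c true  true  = solve 1 (λ c → con 1ℚ := con 1ℚ :- c :* (con 1ℚ :- con 1ℚ)) refl c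
payoff-𝟙 c true  false = solve 1 (λ c → :- c := con 0ℚ :- c :* (con 1ℚ :- con 0ℚ)) refl c
payoff-𝟙 c false y     = solve 1 (λ c → con 0ℚ := con 0ℚ :- c :* (con 0ℚ :- con 0ℚ)) refl c

payoff-𝟙-always : ∀ c x → (if x then 1ℚ else - c) ≡ payoff c (𝟙 x) 1ℚ
payoff-𝟙-always c true  = solve 1 (λ c → con 1ℚ := con 1ℚ :- c :* (con 1ℚ :- con 1ℚ)) refl c
payoff-𝟙-always c false = solve 1 (λ c → :- c := con 0ℚ :- c :* (con 1ℚ :- con 0ℚ)) refl c

regret-≥ : ∀ {k} a m u → 0ℚ ≤ k → a ≤ m → a * k - u * k ≤ (m - u) * k
regret-≥ {k} a m u k≥0 a≤m = begin
  a * k - u * k   ≡⟨ solve 3 (λ a u k → a :* k :- u :* k := (a :- u) :* k) refl a u k ⟩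
  (a - u) * k     ≤⟨ *-monoʳ-≤-nonNeg k {{nonNegative k≥0}} (+-monoˡ-≤ (- u) a≤m) ⟩
  (m - u) * k     ∎
  where open ≤-Reasoning

payoff-bound : ∀ {c γ ε x y} → 0ℚ ≤ x → 0ℚ ≤ y → c ≤ 1ℚ → γ ≤ c →
               - payoff c x y ≤ ε → γ * y ≤ 2ℚ * x + ε
payoff-bound {c} {γ} {ε} {x} {y} x≥0 y≥0 c≤1 γ≤c -payoff≤ε = begin
  γ * y                           ≤⟨ *-monoʳ-≤-nonNeg y {{nonNegative y≥0}} γ≤c ⟩
  c * y                           ≡⟨ solve 3 (λ c x y → c :* y := (con 1ℚ :+ c) :* x :+ :- (x :- c :* (y :- x))) refl c x y ⟩
  (1ℚ + c) * x + - payoff c x y   ≤⟨ +-monoʳ-≤ ((1ℚ + c) * x) -payoff≤ε ⟩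
  (1ℚ + c) * x + ε                ≤⟨ +-monoˡ-≤ ε (*-monoʳ-≤-nonNeg x {{nonNegative x≥0}} (+-monoʳ-≤ 1ℚ c≤1)) ⟩
  2ℚ * x + ε                      ∎
  where open ≤-Reasoning

interference-bound : ∀ {δ σ J f} → 1ℚ ≤ σ + J + f → J ≤ 1ℚ - δ → σ ≤ (+ 3 / 4) * δ →
                     (+ 1 / 4) * δ ≤ f
interference-bound {δ} {σ} {J} {f} cover J≤ σ≤ = begin
  (+ 1 / 4) * δ                 ≡⟨ solve 1 (λ δ → con (+ 1 / 4) :* δ := (con 1ℚ :- con (+ 3 / 4) :* δ) :- (con 1ℚ :- δ)) refl δ ⟩
  (1ℚ - (+ 3 / 4) * δ) - (1ℚ - δ) ≤⟨ +-mono-≤ (+-monoʳ-≤ 1ℚ (neg-antimono-≤ σ≤)) (neg-antimono-≤ J≤) ⟩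
  (1ℚ - σ) - J                  ≤⟨ +-monoˡ-≤ (- J) (+-monoˡ-≤ (- σ) cover) ⟩
  ((σ + J + f) - σ) - J         ≡⟨ solve 3 (λ σ J f → ((σ :+ J :+ f) :- σ) :- J := f) refl σ J f ⟩
  f                             ∎
  where open ≤-Reasoning

*-nonNeg : ∀ {p q} → 0ℚ ≤ p → 0ℚ ≤ q → 0ℚ ≤ p * q
*-nonNeg {p} {q} p≥0 q≥0 =
  nonNegative⁻¹ (p * q) {{nonNeg*nonNeg⇒nonNeg p {{nonNegative p≥0}} q {{nonNegative q≥0}}}}

1≤2-δ : ∀ {δ} → δ ≤ 1ℚ → 1ℚ ≤ 2ℚ - δ
1≤2-δ δ≤1 = +-monoʳ-≤ 2ℚ (neg-antimono-≤ δ≤1)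

module _ {δ : ℚ} .{{_ : NonZero (2ℚ - δ)}} where

  payoff-scaled : ∀ x y → (2ℚ - δ) * payoff (δ ÷ (2ℚ - δ)) x y ≡ 2ℚ * x - δ * y
  payoff-scaled x y = begin
    s * payoff (δ ÷ s) x y       ≡⟨ solve 4 (λ s c x y → s :* (x :- c :* (y :- x)) := s :* x :- (s :* c) :* (y :- x))
                                           refl s (δ ÷ s) x y ⟩
    s * x - s * (δ ÷ s) * (y - x) ≡⟨ cong (λ z → s * x - z * (y - x)) (p*[q÷p]≡q s δ) ⟩
    s * x - δ * (y - x)           ≡⟨ solve 3 (λ δ x y → (con 2ℚ :- δ) :* x :- δ :* (y :- x) := con 2ℚ :* x :- δ :* y)
                                           refl δ x y ⟩
    2ℚ * x - δ * y                ∎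
    where
    open ≡-Reasoning
    s : ℚ
    s = 2ℚ - δ

  module _ (δ≥0 : 0ℚ ≤ δ) (δ≤1 : δ ≤ 1ℚ) where
    private
      s>0 : 0ℚ < 2ℚ - δ
      s>0 = <-≤-trans (positive⁻¹ 1ℚ) (1≤2-δ δ≤1)

      instance
        s-positive : Positive (2ℚ - δ)
        s-positive = positive s>0

        s-nonNegative : NonNegative (2ℚ - δ)
        s-nonNegative = pos⇒nonNeg (2ℚ - δ)

    ÷-≤-1 : δ ÷ (2ℚ - δ) ≤ 1ℚ
    ÷-≤-1 = *-cancelˡ-≤-pos (2ℚ - δ) (begin
      s * (δ ÷ s)  ≡⟨ p*[q÷p]≡q s δ ⟩
      δ            ≤⟨ ≤-trans δ≤1 (1≤2-δ δ≤1) ⟩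
      s            ≡⟨ *-identityʳ s ⟨
      s * 1ℚ       ∎)
      where
      open ≤-Reasoning
      s : ℚ
      s = 2ℚ - δ

    half-≤-÷ : δ * ½ ≤ δ ÷ (2ℚ - δ)
    half-≤-÷ = *-cancelˡ-≤-pos (2ℚ - δ) (begin
      s * (δ * ½)          ≡⟨ solve 1 (λ δ → (con 2ℚ :- δ) :* (δ :* con ½) := δ :- con ½ :* (δ :* δ)) refl δ ⟩
      δ - ½ * (δ * δ)      ≤⟨ +-monoʳ-≤ δ (neg-antimono-≤ (*-nonNeg {½} (≤ᵇ⇒≤ tt) (*-nonNeg δ≥0 δ≥0))) ⟩
      δ + - 0ℚ             ≡⟨ +-identityʳ δ ⟩
      δ                    ≡⟨ p*[q÷p]≡q s δ ⟨
      s * (δ ÷ s)          ∎)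
      where
      open ≤-Reasoning
      s : ℚ
      s = 2ℚ - δ

    threshold-scaled : ∀ {ε} → ε < (+ 1 / 4) * ((δ * δ) ÷ (2ℚ - δ)) →
                       (2ℚ - δ) * ε ≤ (+ 1 / 4) * (δ * δ)
    threshold-scaled {ε} ε< = begin
      s * ε                               ≤⟨ *-monoˡ-≤-nonNeg s (<⇒≤ ε<) ⟩
      s * ((+ 1 / 4) * ((δ * δ) ÷ s))     ≡⟨ solve 3 (λ s a x → s :* (a :* x) := a :* (s :* x)) refl s (+ 1 / 4) _ ⟩
      (+ 1 / 4) * (s * ((δ * δ) ÷ s))     ≡⟨ cong ((+ 1 / 4) *_) (p*[q÷p]≡q s (δ * δ)) ⟩
      (+ 1 / 4) * (δ * δ)                 ∎
      where
      open ≤-Reasoning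
      s : ℚ
      s = 2ℚ - δ

    always-regret⇒σ≤¾δ : ∀ {ε σ w q} → payoff (δ ÷ (2ℚ - δ)) σ 1ℚ - payoff (δ ÷ (2ℚ - δ)) w q ≤ ε →
                         ε < (+ 1 / 4) * ((δ * δ) ÷ (2ℚ - δ)) → w ≤ q → q ≤ (+ 1 / 4) * δ →
                         σ ≤ (+ 3 / 4) * δ
    always-regret⇒σ≤¾δ {ε} {σ} {w} {q} regret≤ε ε< w≤q q≤ = begin
      σ                                                ≡⟨ σ≡ ⟩
      ½ * (s * R + (2ℚ * w - δ * q) + δ * 1ℚ)          ≤⟨ *-monoˡ-≤-nonNeg ½ (+-monoˡ-≤ (δ * 1ℚ) (+-mono-≤ sR≤ 2w-δq≤sq)) ⟩
      ½ * ((+ 1 / 4) * (δ * δ) + s * q + δ * 1ℚ)       ≤⟨ *-monoˡ-≤-nonNeg ½ (+-monoˡ-≤ (δ * 1ℚ)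
                                                            (+-monoʳ-≤ ((+ 1 / 4) * (δ * δ)) (*-monoˡ-≤-nonNeg s q≤))) ⟩
      ½ * ((+ 1 / 4) * (δ * δ) + s * ((+ 1 / 4) * δ) + δ * 1ℚ)
        ≡⟨ solve 1 (λ δ → con ½ :* (con (+ 1 / 4) :* (δ :* δ) :+ (con 2ℚ :- δ) :* (con (+ 1 / 4) :* δ) :+ δ :* con 1ℚ)
                          := con (+ 3 / 4) :* δ) refl δ ⟩
      (+ 3 / 4) * δ                                    ∎
      where
      open ≤-Reasoning
      s c R : ℚ
      s = 2ℚ - δ
      c = δ ÷ s
      R = payoff c σ 1ℚ - payoff c w q
      sR≡ : s * R ≡ (2ℚ * σ - δ * 1ℚ) - (2ℚ * w - δ * q)
      sR≡ = ≡-trans (solve 3 (λ s a b → s :* (a :- b) := s :* a :- s :* b) refl s _ _)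
                    (cong₂ _-_ (payoff-scaled σ 1ℚ) (payoff-scaled w q))
      σ≡ : σ ≡ ½ * (s * R + (2ℚ * w - δ * q) + δ * 1ℚ)
      σ≡ = ≡-trans (solve 4 (λ σ δ w q → σ := con ½ :* ((con 2ℚ :* σ :- δ :* con 1ℚ) :- (con 2ℚ :* w :- δ :* q)
                                                     :+ (con 2ℚ :* w :- δ :* q) :+ δ :* con 1ℚ)) refl σ δ w q)
                   (cong (λ z → ½ * (z + (2ℚ * w - δ * q) + δ * 1ℚ)) (sym sR≡))
      sR≤ : s * R ≤ (+ 1 / 4) * (δ * δ)
      sR≤ = ≤-trans (*-monoˡ-≤-nonNeg s regret≤ε) (threshold-scaled ε<)
      2w-δq≤sq : 2ℚ * w - δ * q ≤ s * q
      2w-δq≤sq = ≤-trans (+-monoˡ-≤ (- (δ * q)) (*-monoˡ-≤-nonNeg 2ℚ w≤q))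
                         (≤-reflexive (solve 2 (λ δ q → con 2ℚ :* q :- δ :* q := (con 2ℚ :- δ) :* q) refl δ q))

module Frequencies {n} (b : Fin n → Fin n → ℚ) (trans jam : ℕ → Fin n → Bool)
                   (T : ℕ) .{{_ : ℕ.NonZero T}} where
  open Setting b trans jam

  wAlways : Fin n → ℚ
  wAlways v = frac T (λ t → successIfTransmit t v)

  jamFrac : Fin n → ℚ
  jamFrac v = frac T (λ t → jam t v)

  w-nonNeg : ∀ v → 0ℚ ≤ w T v
  w-nonNeg v = mean-nonNeg T (λ t → 𝟙-nonNeg (success t v))

  w≤q : ∀ v → w T v ≤ q T v
  w≤q v = mean-mono-≤ T (λ t → 𝟙-∧-≤ (trans t v) _)

  q-nonNeg : ∀ v → 0ℚ ≤ q T v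
  q-nonNeg v = ≤-trans (w-nonNeg v) (w≤q v)

  mean-utility : ∀ c v → mean T (λ t → utility c t v) ≡ payoff c (w T v) (q T v)
  mean-utility c v = ≡-trans (mean-cong T (λ t → payoff-𝟙 c (trans t v) _)) (mean-payoff T c _ _)

  mean-utilityAlways : ∀ c v → mean T (λ t → utilityAlways c t v) ≡ payoff c (wAlways v) 1ℚ
  mean-utilityAlways c v = begin
    mean T (λ t → utilityAlways c t v)                        ≡⟨ mean-cong T (λ t → payoff-𝟙-always c (successIfTransmit t v)) ⟩
    mean T (λ t → payoff c (𝟙 (successIfTransmit t v)) 1ℚ)    ≡⟨ mean-payoff T c _ (λ _ → 1ℚ) ⟩
    payoff c (wAlways v) (mean T (λ _ → 1ℚ))                  ≡⟨ cong (payoff c (wAlways v)) (mean-const T 1ℚ) ⟩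
    payoff c (wAlways v) 1ℚ                                   ∎
    where open ≡-Reasoning

  module _ {c ε} (v : Fin n) (regret≤ε : avgRegret T c v ≤ ε) where
    private
      ΣA ΣN ΣU : ℚ
      ΣA = ΣT T (λ t → utilityAlways c t v)
      ΣN = ΣT T (λ t → utilityNever c t v)
      ΣU = ΣT T (λ t → utility c t v)

    regret-vs-never : - payoff c (w T v) (q T v) ≤ ε
    regret-vs-never = begin
      - payoff c (w T v) (q T v)                      ≡⟨ +-identityˡ _ ⟨
      0ℚ - payoff c (w T v) (q T v)                   ≡⟨ cong₂ _-_ (mean-const T 0ℚ) (mean-utility c v) ⟨
      mean T (λ _ → 0ℚ) - mean T (λ t → utility c t v) ≤⟨ regret-≥ ΣN (ΣA ⊔ ΣN) ΣU (1/ℕ-nonNeg T) (p≤q⊔p ΣA ΣN) ⟩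
      avgRegret T c v                                 ≤⟨ regret≤ε ⟩
      ε                                               ∎
      where open ≤-Reasoning

    regret-vs-always : payoff c (wAlways v) 1ℚ - payoff c (w T v) (q T v) ≤ ε
    regret-vs-always = begin
      payoff c (wAlways v) 1ℚ - payoff c (w T v) (q T v)          ≡⟨ cong₂ _-_ (mean-utilityAlways c v) (mean-utility c v) ⟨
      mean T (λ t → utilityAlways c t v) - mean T (λ t → utility c t v) ≤⟨ regret-≥ ΣA (ΣA ⊔ ΣN) ΣU (1/ℕ-nonNeg T) (p≤p⊔q ΣA ΣN) ⟩
      avgRegret T c v                                             ≤⟨ regret≤ε ⟩
      ε                                                           ∎
      where open ≤-Reasoning

  1≤wAlways+jamFrac+f : ∀ v → 1ℚ ≤ wAlways v + jamFrac v + f T v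
  1≤wAlways+jamFrac+f v = begin
    1ℚ                                  ≡⟨ mean-const T 1ℚ ⟨
    mean T (λ _ → 1ℚ)                   ≤⟨ mean-mono-≤ T (λ t → 𝟙-cover (jam t v) (interfered t v)) ⟩
    mean T (λ t → S t + J t + I t)      ≡⟨ mean-distrib-+ T (λ t → S t + J t) I ⟩
    mean T (λ t → S t + J t) + f T v    ≡⟨ cong (_+ f T v) (mean-distrib-+ T S J) ⟩
    wAlways v + jamFrac v + f T v       ∎
    where
    open ≤-Reasoning
    S J I : ℕ → ℚ
    S t = 𝟙 (successIfTransmit t v)
    J t = 𝟙 (jam t v)
    I t = 𝟙 (interfered t v)

  jamFrac-≤ : ∀ {T' δ} → T' ℕ.≤ T → Bounded T' δ jam → ∀ v → jamFrac v ≤ 1ℚ - δ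
  jamFrac-≤ {δ = δ} T'≤T bounded v = mean-≤ T (1ℚ - δ) (bounded v 0 T T'≤T)

  module _ (b≥0 : ∀ u v → 0ℚ ≤ b u v) (b[v,v]≡0 : ∀ v → b v v ≡ 0ℚ) where

    load-nonNeg : ∀ t v → 0ℚ ≤ load t v
    load-nonNeg t v = ΣL-nonNeg term-nonNeg
      where
      term-nonNeg : ∀ u → 0ℚ ≤ (if trans t u then b u v else 0ℚ)
      term-nonNeg u with trans t u
      ... | true  = b≥0 u v
      ... | false = ≤-refl

    loadWith≡load : ∀ t v → loadWith t v ≡ load t v
    loadWith≡load t v = ΣL-cong same-term
      where
      same-term : ∀ u → (if trans t u ∨ isYes (u Fin.≟ v) then b u v else 0ℚ) ≡ (if trans t u then b u v else 0ℚ)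
      same-term u with trans t u | u Fin.≟ v
      ... | true  | _        = refl
      ... | false | yes refl = b[v,v]≡0 v
      ... | false | no _     = refl

    f≤Σbq : ∀ v → f T v ≤ ΣL (λ u → b u v * q T u)
    f≤Σbq v = begin
      f T v                                                  ≤⟨ mean-mono-≤ T interfered≤load ⟩
      mean T (λ t → load t v)                                ≡⟨ mean-ΣL-comm T (λ t u → if trans t u then b u v else 0ℚ) ⟩
      ΣL (λ u → mean T (λ t → if trans t u then b u v else 0ℚ)) ≡⟨ ΣL-cong (λ u → mean-cong T (λ t → if-then-0≡*𝟙 (trans t u) (b u v))) ⟩
      ΣL (λ u → mean T (λ t → b u v * 𝟙 (trans t u)))        ≡⟨ ΣL-cong (λ u → *-distribˡ-mean T (b u v) _) ⟨
      ΣL (λ u → b u v * q T u)                               ∎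
      where
      open ≤-Reasoning
      interfered≤load : ∀ t → 𝟙 (interfered t v) ≤ load t v
      interfered≤load t = subst (𝟙 (interfered t v) ≤_) (loadWith≡load t v)
        (𝟙-exceeds-1 (subst (0ℚ ≤_) (sym (loadWith≡load t v)) (load-nonNeg t v)))

lemma2 : ∀ {n} (b : Fin n → Fin n → ℚ) (trans jam : ℕ → Fin n → Bool)
           (T T' : ℕ) .{{_ : ℕ.NonZero T}}
           (δ ε : ℚ) .{{_ : NonZero (2ℚ - δ)}} →
         0ℚ < δ → δ ≤ 1ℚ →
         (∀ u v → 0ℚ ≤ b u v) → (∀ v → b v v ≡ 0ℚ) →
         1 ℕ.≤ T' → T' ℕ.≤ T →
         Bounded T' δ jam →
         (∀ v → Setting.avgRegret b trans jam T (δ ÷ (2ℚ - δ)) v ≤ ε) →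
         ε < (+ 1 / 4) * ((δ * δ) ÷ (2ℚ - δ)) →
         Setting.Successful b trans jam T (δ * ½) ε
           × Setting.Blocking b trans jam T δ
lemma2 b trans jam T T' δ ε δ>0 δ≤1 b≥0 b[v,v]≡0 _ T'≤T bounded regret≤ε ε< = successful , blocking
  where
  open Setting b trans jam
  open Frequencies b trans jam T
  δ≥0 : 0ℚ ≤ δ
  δ≥0 = <⇒≤ δ>0

  successful : Successful T (δ * ½) ε
  successful v = payoff-bound (w-nonNeg v) (q-nonNeg v) (÷-≤-1 δ≥0 δ≤1) (half-≤-÷ δ≥0 δ≤1)
                              (regret-vs-never v (regret≤ε v))

  blocking : Blocking T δ
  blocking v q≤¼δ = ¼δ≤f , ≤-trans ⅛δ≤¼δ (≤-trans ¼δ≤f (f≤Σbq b≥0 b[v,v]≡0 v))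
    where
    σ≤¾δ : wAlways v ≤ (+ 3 / 4) * δ
    σ≤¾δ = always-regret⇒σ≤¾δ δ≥0 δ≤1 {σ = wAlways v} (regret-vs-always v (regret≤ε v)) ε< (w≤q v) q≤¼δ
    ¼δ≤f : (+ 1 / 4) * δ ≤ f T v
    ¼δ≤f = interference-bound {δ = δ} (1≤wAlways+jamFrac+f v) (jamFrac-≤ {δ = δ} T'≤T bounded v) σ≤¾δ
    ⅛δ≤¼δ : (+ 1 / 8) * δ ≤ (+ 1 / 4) * δ
    ⅛δ≤¼δ = *-monoʳ-≤-nonNeg δ {{nonNegative δ≥0}} {+ 1 / 8} {+ 1 / 4} (≤ᵇ⇒≤ tt)
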